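{- For every $n\geq 1$, $$B_{2n+2} = \{0\}\cup\{M_{2n+2}\}\cup\{0p_{2(n-i)+1}0 : i\in\{0,1,\ldots,n-1\}\},$$ $$B_{2n+3} = \{1\}\cup\{M_{2n+3}\}\cup\{1p_{2(n-i)+2}1 : i\in\{0,1,\ldots,n-1\}\},$$ and $B_3=\{1,11\}$.
   Context: Finite Fibonacci words: $f_1=1$, $f_2=0$, $f_{n+2}=f_{n+1}f_n$. For $n\geq 3$, $p_n$ is $f_n$ with its last two letters deleted ($p_3=\epsilon$, $p_4=0$, $p_5=010$, ...). The minimal forbidden factors of the infinite Fibonacci word are $M_{2n+1}=1p_{2n+1}1$ and $M_{2n+2}=0p_{2n+2}0$ for $n\geq 1$ (so $M_3=11$). A word $b$ is a border of $w$ if $w=xb=by$ for some words $x,y$. For $n\geq 3$, $B_n$ is the set of all nonempty borders of $M_n$. -}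

module Defs where

open import Data.Nat using (ℕ; zero; suc; _+_; _*_)
open import Data.List using (List; []; _∷_; _++_; reverse; drop)
open import Data.Product using (Σ; ∃; _×_; _,_)
open import Relation.Binary.PropositionalEquality using (_≡_; _≢_)

data Bit : Set where
  𝟎 𝟏 : Bit

Word : Set
Word = List Bit

-- finite Fibonacci words f₁ = 1, f₂ = 0, f_{n+2} = f_{n+1} f_n
-- (f 0 is a junk value, never used)
fib : ℕ → Word
fib zero = []
fib (suc zero) = 𝟏 ∷ []
fib (suc (suc zero)) = 𝟎 ∷ []
fib (suc (suc (suc n))) = fib (suc (suc n)) ++ fib (suc n)

dropLast2 : Word → Word
dropLast2 w = reverse (drop 2 (reverse w))

-- p n = f n with last two letters deleted (meaningful for n ≥ 3)
p : ℕ → Word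
p n = dropLast2 (fib n)

M-odd : ℕ → Word   -- M-odd n = M_{2n+1}
M-odd n = 𝟏 ∷ (p (2 * n + 1) ++ 𝟏 ∷ [])

M-even : ℕ → Word  -- M-even n = M_{2n+2}
M-even n = 𝟎 ∷ (p (2 * n + 2) ++ 𝟎 ∷ [])

IsNonemptyBorder : Word → Word → Set
IsNonemptyBorder b w =
  (b ≢ []) × (∃ λ x → w ≡ x ++ b) × (∃ λ y → w ≡ b ++ y)

{-# OPTIONS --safe #-}
module Submission where

-- The words p_k are nested: for k < n, p_k is a border of p_n whose occurrence as a prefix is
-- followed, and whose occurrence as a suffix is preceded, by 0 if k is odd and by 1 if k is even.
-- These are all the borders of p_n, because p_{n+2} = f_n p_{n+1} has no period shorter than
-- |f_n|, so no border of p_{n+2} is longer than p_{n+1} without being all of p_{n+2}.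
-- A nonempty border of a p_n a other than a and a p_n a is a m a with m a border of p_n followed
-- and preceded by a in this sense, hence m = p_k for some k < n of the parity determined by a.

open import Defs
open import Data.Nat using (ℕ; zero; suc; _+_; _*_; _∸_; _<_; _≥_; _≤_; z≤n; s≤s; _<?_; _≤?_; _≤′_; ≤′-refl; ≤′-step)
open import Data.Nat.Properties
open import Data.Nat.Tactic.RingSolver using (solve-∀)
open import Data.List using (List; []; _∷_; _++_; _∷ʳ_; length; reverse; drop; initLast; _∷ʳ′_)
open import Data.List.Properties using (++-assoc; length-++; ++-identityʳ; ++-identityʳ-unique; ++-cancelˡ; reverse-++; reverse-involutive; ∷-injective; ∷-injectiveʳ; ∷ʳ-injective)
open import Data.Maybe using (Maybe; just; nothing)
open import Data.Product using (∃; _×_; _,_; proj₁; proj₂)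
import Data.Product as Product
open import Data.Sum using (_⊎_; inj₁; inj₂; [_,_]; map₂)
open import Data.Sum.Function.Propositional using (_⊎-⇔_)
open import Data.Empty using (⊥; ⊥-elim)
open import Function using (id; _∘_)
open import Function.Bundles using (_⇔_; mk⇔; Equivalence)
import Function.Properties.Equivalence as ⇔
open import Relation.Nullary using (¬_; Dec; yes; no)
open import Relation.Binary.PropositionalEquality using (_≡_; _≢_; refl; sym; trans; cong; subst; module ≡-Reasoning)

module _ {A : Set} where

  IsBorder : List A → List A → Set
  IsBorder b w = (∃ λ x → w ≡ x ++ b) × (∃ λ y → w ≡ b ++ y)

  prefix-of-longer : ∀ (u v x y : List A) → u ++ v ≡ x ++ y → length u ≤ length x →
                     ∃ λ r → x ≡ u ++ r
  prefix-of-longer []      v x       y _ _ = x , refl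
  prefix-of-longer (a ∷ u) v (b ∷ x) y e (s≤s u≤x) with refl , e′ ← ∷-injective e =
    Product.map₂ (cong (a ∷_)) (prefix-of-longer u v x y e′ u≤x)

  suffix-of-longer : ∀ (u v x y : List A) → u ++ v ≡ x ++ y → length v ≤ length y →
                     ∃ λ r → y ≡ r ++ v
  suffix-of-longer u       v []      y e _ = u , sym e
  suffix-of-longer []      v (a ∷ x) y e v≤y = ⊥-elim (<⇒≱ y<v v≤y)
    where
    y<v : length y < length v
    y<v = begin-strict
      length y           ≤⟨ m≤n+m (length y) (length x) ⟩
      length x + length y ≡⟨ length-++ x ⟨
      length (x ++ y)    <⟨ ≤-refl ⟩
      length (a ∷ x ++ y) ≡⟨ cong length e ⟨
      length v           ∎
      where open ≤-Reasoning
  suffix-of-longer (_ ∷ u) v (_ ∷ x) y e v≤y = suffix-of-longer u v x y (∷-injectiveʳ e) v≤y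

  border-of-border : ∀ {c b w} → IsBorder c w → IsBorder b w → length c ≤ length b → IsBorder c b
  border-of-border ((x₁ , w≡x₁c) , (y₁ , w≡cy₁)) ((x₂ , w≡x₂b) , (y₂ , w≡by₂)) c≤b =
    suffix-of-longer x₁ _ x₂ _ (trans (sym w≡x₁c) w≡x₂b) c≤b ,
    prefix-of-longer _ y₁ _ y₂ (trans (sym w≡cy₁) w≡by₂) c≤b

  border-trans : ∀ {a b c} → IsBorder a b → IsBorder b c → IsBorder a c
  border-trans {a} ((x , b≡xa) , (y , b≡ay)) ((x′ , c≡x′b) , (y′ , c≡by′)) =
    (x′ ++ x , trans c≡x′b (trans (cong (x′ ++_) b≡xa) (sym (++-assoc x′ x a)))) ,
    (y ++ y′ , trans c≡by′ (trans (cong (_++ y′) b≡ay) (++-assoc a y y′)))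

  prefix-of-no-shorter : ∀ {b w : List A} y → w ≡ b ++ y → length w ≤ length b → b ≡ w
  prefix-of-no-shorter {b} []      w≡b _    = trans (sym (++-identityʳ b)) (sym w≡b)
  prefix-of-no-shorter {b} {w} (a ∷ y) w≡b w≤b = ⊥-elim (<⇒≱ b<w w≤b)
    where
    b<w : length b < length w
    b<w = subst (length b <_) (cong length (sym w≡b))
            (subst (length b <_) (sym (length-++ b)) (m<m+n (length b) (s≤s z≤n)))

  enclose : A → List A → List A
  enclose a w = a ∷ (w ++ a ∷ [])

  IsFlankedBorder : A → List A → List A → Set
  IsFlankedBorder a m w = (∃ λ x → w ≡ x ++ a ∷ m) × (∃ λ y → w ≡ m ++ a ∷ y)

  flanked⇒border : ∀ {a m w} → IsFlankedBorder a m w → IsBorder m w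
  flanked⇒border {a} {m} ((x , w≡xam) , (y , w≡may)) =
    (x ∷ʳ a , trans w≡xam (sym (++-assoc x (a ∷ []) m))) , (a ∷ y , w≡may)

  flanked-extend : ∀ {a m w v} → IsFlankedBorder a m w → IsBorder w v → IsFlankedBorder a m v
  flanked-extend {a} {m} {w} ((x , w≡xam) , (y , w≡may)) ((x′ , v≡x′w) , (y′ , v≡wy′)) =
    (x′ ++ x , trans v≡x′w (trans (cong (x′ ++_) w≡xam) (sym (++-assoc x′ x (a ∷ m))))) ,
    (y ++ y′ , trans v≡wy′ (trans (cong (_++ y′) w≡may) (++-assoc m (a ∷ y) y′)))

  borders-enclose⇒ : ∀ a w b → b ≢ [] → IsBorder b (enclose a w) →
    b ≡ a ∷ [] ⊎ b ≡ enclose a w ⊎ ∃ λ m → IsFlankedBorder a m w × b ≡ enclose a m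
  borders-enclose⇒ a w []      b≢[] _ = ⊥-elim (b≢[] refl)
  borders-enclose⇒ a w (c ∷ b) _ ((x , ≡xcb) , (y , ≡cby))
    with refl , w∷ʳa≡by ← ∷-injective ≡cby | initLast b
  ... | [] = inj₁ refl
  ... | m ∷ʳ′ z
    with aw≡xam , refl ← ∷ʳ-injective (a ∷ w) (x ++ a ∷ m) (trans ≡xcb (sym (++-assoc x (a ∷ m) (z ∷ []))))
    with x
  ... | [] = inj₂ (inj₁ (cong (enclose a) (sym (∷-injectiveʳ aw≡xam))))
  ... | _ ∷ x′ with refl , w≡x′am ← ∷-injective aw≡xam =
    inj₂ (inj₂ (m , ((x′ , w≡x′am) , Product.map₂ (λ {r} e → trans e (++-assoc m (a ∷ []) r)) ma-prefix) , refl))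
    where
    ma≤w : length (m ∷ʳ a) ≤ length w
    ma≤w = begin
      length (m ∷ʳ a)            ≡⟨ length-++ m ⟩
      length m + 1               ≡⟨ +-comm (length m) 1 ⟩
      suc (length m)             ≤⟨ m≤n+m _ (length x′) ⟩
      length x′ + suc (length m) ≡⟨ length-++ x′ ⟨
      length (x′ ++ a ∷ m)       ≡⟨ cong length w≡x′am ⟨
      length w                   ∎
      where open ≤-Reasoning
    ma-prefix : ∃ λ r → w ≡ (m ∷ʳ a) ++ r
    ma-prefix = prefix-of-longer (m ∷ʳ a) y w (a ∷ []) (sym w∷ʳa≡by) ma≤w

  borders-enclose⇐ : ∀ a w b →
    b ≡ a ∷ [] ⊎ b ≡ enclose a w ⊎ (∃ λ m → IsFlankedBorder a m w × b ≡ enclose a m) →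
    b ≢ [] × IsBorder b (enclose a w)
  borders-enclose⇐ a w _ (inj₁ refl) = (λ ()) , (a ∷ w , refl) , (w ∷ʳ a , refl)
  borders-enclose⇐ a w _ (inj₂ (inj₁ refl)) = (λ ()) , ([] , refl) , ([] , sym (++-identityʳ _))
  borders-enclose⇐ a w _ (inj₂ (inj₂ (m , ((x , w≡xam) , (y , w≡may)) , refl))) =
    (λ ()) ,
    (a ∷ x , cong (a ∷_) (trans (cong (_∷ʳ a) w≡xam) (++-assoc x (a ∷ m) (a ∷ [])))) ,
    (y ∷ʳ a , cong (a ∷_) (trans (cong (_∷ʳ a) w≡may)
                 (trans (++-assoc m (a ∷ y) (a ∷ [])) (sym (++-assoc m (a ∷ []) (y ∷ʳ a))))))

  borders-enclose : ∀ a w b → (b ≢ [] × IsBorder b (enclose a w)) ⇔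
    (b ≡ a ∷ [] ⊎ b ≡ enclose a w ⊎ ∃ λ m → IsFlankedBorder a m w × b ≡ enclose a m)
  borders-enclose a w b =
    mk⇔ (λ (b≢[] , border) → borders-enclose⇒ a w b b≢[] border) (borders-enclose⇐ a w b)

  _‼_ : List A → ℕ → Maybe A
  []      ‼ _     = nothing
  (a ∷ _) ‼ zero  = just a
  (_ ∷ w) ‼ suc i = w ‼ i

  ‼-++ˡ : ∀ u v i {a} → u ‼ i ≡ just a → (u ++ v) ‼ i ≡ just a
  ‼-++ˡ (_ ∷ u) v zero    e = e
  ‼-++ˡ (_ ∷ u) v (suc i) e = ‼-++ˡ u v i e

  ‼-++ʳ : ∀ u v i → (u ++ v) ‼ (length u + i) ≡ v ‼ i
  ‼-++ʳ []      v i = refl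
  ‼-++ʳ (_ ∷ u) v i = ‼-++ʳ u v i

  ‼-++-< : ∀ u v i {a} → (u ++ v) ‼ i ≡ just a → i < length u → u ‼ i ≡ just a
  ‼-++-< (_ ∷ u) v zero    e _         = e
  ‼-++-< (_ ∷ u) v (suc i) e (s≤s i<u) = ‼-++-< u v i e i<u

  ‼-just⇒< : ∀ w i {a} → w ‼ i ≡ just a → i < length w
  ‼-just⇒< (_ ∷ w) zero    _ = s≤s z≤n
  ‼-just⇒< (_ ∷ w) (suc i) e = s≤s (‼-just⇒< w i e)

  <⇒‼-just : ∀ w i → i < length w → ∃ λ a → w ‼ i ≡ just a
  <⇒‼-just (a ∷ w) zero    _         = a , refl
  <⇒‼-just (_ ∷ w) (suc i) (s≤s i<w) = <⇒‼-just w i i<w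

  HasPeriod : ℕ → List A → Set
  HasPeriod d w = ∀ i {a} → w ‼ (d + i) ≡ just a → w ‼ i ≡ just a

  period-prefix : ∀ {d} u v → HasPeriod d (u ++ v) → HasPeriod d u
  period-prefix {d} u v per i e =
    ‼-++-< u v i (per i (‼-++ˡ u v (d + i) e)) (≤-<-trans (m≤n+m i d) (‼-just⇒< u (d + i) e))

  border⇒period : ∀ {w v} x y → w ≡ x ++ v → w ≡ v ++ y → HasPeriod (length x) w
  border⇒period {v = v} x y w≡xv w≡vy i {a} e =
    subst (λ w → w ‼ i ≡ just a) (sym w≡vy) (‼-++ˡ v y i v‼i)
    where
    v‼i : v ‼ i ≡ just a
    v‼i = trans (sym (‼-++ʳ x v i)) (trans (cong (_‼ (length x + i)) (sym w≡xv)) e)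

  -- Positions Q ∸ d + i and i both carry the letter at Q + i: the first by period d, the second by period Q.
  period-difference : ∀ {d Q} u v → d ≤ Q → d ≤ length v →
    HasPeriod d (u ++ v) → HasPeriod Q (u ++ v) → HasPeriod (Q ∸ d) u
  period-difference {d} {Q} u v d≤Q d≤v per-d per-Q i {a} e =
    trans (‼-++-< u v i (per-Q i w‼Q+i) i<u) (sym a≡c)
    where
    w : List A
    w = u ++ v
    Q∸d+i<u : Q ∸ d + i < length u
    Q∸d+i<u = ‼-just⇒< u _ e
    i<u : i < length u
    i<u = ≤-<-trans (m≤n+m i (Q ∸ d)) Q∸d+i<u
    d+[Q∸d+i]≡Q+i : d + (Q ∸ d + i) ≡ Q + i
    d+[Q∸d+i]≡Q+i = trans (sym (+-assoc d (Q ∸ d) i)) (cong (_+ i) (m+[n∸m]≡n d≤Q))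
    Q+i<w : Q + i < length w
    Q+i<w = begin-strict
      Q + i               ≡⟨ d+[Q∸d+i]≡Q+i ⟨
      d + (Q ∸ d + i)     <⟨ +-monoʳ-< d Q∸d+i<u ⟩
      d + length u        ≤⟨ +-monoˡ-≤ (length u) d≤v ⟩
      length v + length u ≡⟨ +-comm (length v) (length u) ⟩
      length u + length v ≡⟨ length-++ u ⟨
      length w            ∎
      where open ≤-Reasoning
    c : A
    c = proj₁ (<⇒‼-just w (Q + i) Q+i<w)
    w‼Q+i : w ‼ (Q + i) ≡ just c
    w‼Q+i = proj₂ (<⇒‼-just w (Q + i) Q+i<w)
    a≡c : just a ≡ just c
    a≡c = trans (sym (‼-++ˡ u v _ e)) (per-d (Q ∸ d + i) (trans (cong (w ‼_) d+[Q∸d+i]≡Q+i) w‼Q+i))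

-- f′ m and p′ m are f_{m+3} and p_{m+3} (see p≡p′); letter j is the last letter of f_{j+2}.
letter : ℕ → Bit
letter zero          = 𝟎
letter (suc zero)    = 𝟏
letter (suc (suc j)) = letter j

f′ : ℕ → Word
f′ m = fib (3 + m)

p′ : ℕ → Word
p′ zero          = []
p′ (suc zero)    = 𝟎 ∷ []
p′ (suc (suc m)) = f′ (suc m) ++ p′ m

f′≡p′++lastTwo : ∀ m → f′ m ≡ p′ m ++ letter m ∷ letter (suc m) ∷ []
f′≡p′++lastTwo zero          = refl
f′≡p′++lastTwo (suc zero)    = refl
f′≡p′++lastTwo (suc (suc m)) = begin
  f′ (suc m) ++ f′ m                                          ≡⟨ cong (f′ (suc m) ++_) (f′≡p′++lastTwo m) ⟩
  f′ (suc m) ++ (p′ m ++ letter m ∷ letter (suc m) ∷ [])     ≡⟨ ++-assoc (f′ (suc m)) (p′ m) _ ⟨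
  p′ (2 + m) ++ letter (2 + m) ∷ letter (3 + m) ∷ []         ∎
  where open ≡-Reasoning

dropLast2-++ : ∀ w a b → dropLast2 (w ++ a ∷ b ∷ []) ≡ w
dropLast2-++ w a b = begin
  reverse (drop 2 (reverse (w ++ a ∷ b ∷ []))) ≡⟨ cong (reverse ∘ drop 2) (reverse-++ w (a ∷ b ∷ [])) ⟩
  reverse (reverse w)                          ≡⟨ reverse-involutive w ⟩
  w                                            ∎
  where open ≡-Reasoning

p≡p′ : ∀ m → p (3 + m) ≡ p′ m
p≡p′ m = trans (cong dropLast2 (f′≡p′++lastTwo m)) (dropLast2-++ (p′ m) _ _)

p′-unfoldʳ : ∀ m → p′ (2 + m) ≡ p′ (suc m) ++ letter (suc m) ∷ letter (2 + m) ∷ p′ m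
p′-unfoldʳ m = trans (cong (_++ p′ m) (f′≡p′++lastTwo (suc m))) (++-assoc (p′ (suc m)) _ (p′ m))

p′-unfoldˡ : ∀ m → p′ (2 + m) ≡ f′ m ++ p′ (suc m)
p′-unfoldˡ zero    = refl
p′-unfoldˡ (suc m) = begin
  (f′ (suc m) ++ f′ m) ++ p′ (suc m) ≡⟨ ++-assoc (f′ (suc m)) (f′ m) (p′ (suc m)) ⟩
  f′ (suc m) ++ (f′ m ++ p′ (suc m)) ≡⟨ cong (f′ (suc m) ++_) (p′-unfoldˡ m) ⟨
  f′ (suc m) ++ p′ (2 + m)           ∎
  where open ≡-Reasoning

∣f′∣ : ℕ → ℕ
∣f′∣ m = length (f′ m)

∣f′∣-rec : ∀ m → ∣f′∣ (2 + m) ≡ ∣f′∣ (suc m) + ∣f′∣ m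
∣f′∣-rec m = length-++ (f′ (suc m))

∣f′∣-positive : ∀ m → 0 < ∣f′∣ m
∣f′∣-positive zero          = s≤s z≤n
∣f′∣-positive (suc zero)    = s≤s z≤n
∣f′∣-positive (suc (suc m)) =
  subst (0 <_) (sym (∣f′∣-rec m)) (≤-trans (∣f′∣-positive (suc m)) (m≤m+n _ _))

∣f′∣-increasing : ∀ m → ∣f′∣ m < ∣f′∣ (suc m)
∣f′∣-increasing zero    = s≤s (s≤s (s≤s z≤n))
∣f′∣-increasing (suc m) =
  subst (∣f′∣ (suc m) <_) (sym (∣f′∣-rec m)) (m<m+n (∣f′∣ (suc m)) (∣f′∣-positive m))

∣f′∣-gap< : ∀ m → ∣f′∣ (suc m) ∸ ∣f′∣ m < ∣f′∣ m
∣f′∣-gap< zero    = s≤s (s≤s z≤n)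
∣f′∣-gap< (suc m) = begin-strict
  ∣f′∣ (2 + m) ∸ ∣f′∣ (suc m)           ≡⟨ cong (_∸ ∣f′∣ (suc m)) (∣f′∣-rec m) ⟩
  ∣f′∣ (suc m) + ∣f′∣ m ∸ ∣f′∣ (suc m)  ≡⟨ m+n∸m≡n (∣f′∣ (suc m)) (∣f′∣ m) ⟩
  ∣f′∣ m                                <⟨ ∣f′∣-increasing m ⟩
  ∣f′∣ (suc m)                          ∎
  where open ≤-Reasoning

-- A period d ≥ ∣f′∣ M of p′ (3 + M) combines with its period ∣f′∣ (suc M) into the period
-- ∣f′∣ (suc M) ∸ d < ∣f′∣ M of its prefix p′ (2 + M).
p′-no-short-period : ∀ M {d} → 0 < d → d < ∣f′∣ M → ¬ HasPeriod d (p′ (2 + M))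
p′-no-short-period zero {suc zero}    _ _                per with () ← per 0 refl
p′-no-short-period zero {suc (suc d)} _ (s≤s (s≤s ())) _
p′-no-short-period (suc M) {d} 0<d d<∣f′∣suc per = by-cases (d <? ∣f′∣ M)
  where
  rest : Word
  rest = letter (2 + M) ∷ letter (3 + M) ∷ p′ (suc M)
  per′ : HasPeriod d (p′ (2 + M) ++ rest)
  per′ = subst (HasPeriod d) (p′-unfoldʳ (suc M)) per
  per-∣f′∣ : HasPeriod (∣f′∣ (suc M)) (p′ (2 + M) ++ rest)
  per-∣f′∣ = subst (HasPeriod _) (p′-unfoldʳ (suc M))
               (border⇒period (f′ (suc M)) rest (p′-unfoldˡ (suc M)) (p′-unfoldʳ (suc M)))
  ∣rest∣ : length rest ≡ ∣f′∣ (suc M)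
  ∣rest∣ = trans (+-comm 2 _)
             (sym (trans (cong length (f′≡p′++lastTwo (suc M))) (length-++ (p′ (suc M)))))
  by-cases : Dec (d < ∣f′∣ M) → ⊥
  by-cases (yes d<∣f′∣) = p′-no-short-period M 0<d d<∣f′∣ (period-prefix (p′ (2 + M)) rest per′)
  by-cases (no d≮∣f′∣) = p′-no-short-period M (m<n⇒0<n∸m d<∣f′∣suc) gap<∣f′∣
    (period-difference (p′ (2 + M)) rest (<⇒≤ d<∣f′∣suc) d≤∣rest∣ per′ per-∣f′∣)
    where
    d≤∣rest∣ : d ≤ length rest
    d≤∣rest∣ = subst (d ≤_) (sym ∣rest∣) (<⇒≤ d<∣f′∣suc)
    gap<∣f′∣ : ∣f′∣ (suc M) ∸ d < ∣f′∣ M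
    gap<∣f′∣ = ≤-<-trans (∸-monoʳ-≤ _ (≮⇒≥ d≮∣f′∣)) (∣f′∣-gap< M)

p′-proper-border-length : ∀ N {b} → IsBorder b (p′ (suc N)) → length b < length (p′ (suc N)) →
                          length b ≤ length (p′ N)
p′-proper-border-length zero    _ (s≤s b≤0) = b≤0
p′-proper-border-length (suc M) {b} ((x , w≡xb) , (y , w≡by)) b<w = by-cases (length x <? ∣f′∣ M)
  where
  ∣x∣+∣b∣ : length x + length b ≡ length (p′ (2 + M))
  ∣x∣+∣b∣ = trans (sym (length-++ x)) (cong length (sym w≡xb))
  by-cases : Dec (length x < ∣f′∣ M) → length b ≤ length (p′ (suc M))
  by-cases (yes x<∣f′∣) = ⊥-elim (p′-no-short-period M 0<x x<∣f′∣ (border⇒period x y w≡xb w≡by))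
    where
    0<x : 0 < length x
    0<x = +-cancelʳ-< (length b) 0 (length x) (subst (length b <_) (sym ∣x∣+∣b∣) b<w)
  by-cases (no x≮∣f′∣) = +-cancelˡ-≤ (∣f′∣ M) _ _ (begin
    ∣f′∣ M + length b               ≤⟨ +-monoˡ-≤ (length b) (≮⇒≥ x≮∣f′∣) ⟩
    length x + length b             ≡⟨ ∣x∣+∣b∣ ⟩
    length (p′ (2 + M))             ≡⟨ cong length (p′-unfoldˡ M) ⟩
    length (f′ M ++ p′ (suc M))     ≡⟨ length-++ (f′ M) ⟩
    ∣f′∣ M + length (p′ (suc M))    ∎)
    where open ≤-Reasoning

p′-flanked-suc : ∀ j → IsFlankedBorder (letter j) (p′ j) (p′ (suc j))
p′-flanked-suc zero    = ([] , refl) , ([] , refl)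
p′-flanked-suc (suc m) = (p′ m ∷ʳ letter m , suffix) , (letter (2 + m) ∷ p′ m , p′-unfoldʳ m)
  where
  suffix : p′ (2 + m) ≡ (p′ m ∷ʳ letter m) ++ letter (suc m) ∷ p′ (suc m)
  suffix = begin
    p′ (2 + m)                                                  ≡⟨ p′-unfoldˡ m ⟩
    f′ m ++ p′ (suc m)                                          ≡⟨ cong (_++ p′ (suc m)) (f′≡p′++lastTwo m) ⟩
    (p′ m ++ letter m ∷ letter (suc m) ∷ []) ++ p′ (suc m)      ≡⟨ ++-assoc (p′ m) _ (p′ (suc m)) ⟩
    p′ m ++ letter m ∷ letter (suc m) ∷ p′ (suc m)              ≡⟨ ++-assoc (p′ m) (letter m ∷ []) _ ⟨
    (p′ m ∷ʳ letter m) ++ letter (suc m) ∷ p′ (suc m)           ∎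
    where open ≡-Reasoning

p′-border-mono : ∀ {j N} → j ≤′ N → IsBorder (p′ j) (p′ N)
p′-border-mono ≤′-refl             = ([] , refl) , ([] , sym (++-identityʳ _))
p′-border-mono (≤′-step {N} j≤′N) = border-trans (p′-border-mono j≤′N) (flanked⇒border (p′-flanked-suc N))

p′-flanked : ∀ {j N} → j < N → IsFlankedBorder (letter j) (p′ j) (p′ N)
p′-flanked {j} j<N = flanked-extend (p′-flanked-suc j) (p′-border-mono (≤⇒≤′ j<N))

p′-borders : ∀ N {b} → IsBorder b (p′ N) → ∃ λ j → j ≤ N × b ≡ p′ j
p′-borders zero    {[]}    _                = 0 , z≤n , refl
p′-borders zero    {_ ∷ _} (_ , (_ , ()))
p′-borders (suc N) {b} border@(_ , (y , w≡by)) with length b ≤? length (p′ N)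
... | yes b≤p′N = Product.map₂ (Product.map₁ m≤n⇒m≤1+n)
       (p′-borders N (border-of-border border (flanked⇒border (p′-flanked-suc N)) b≤p′N))
... | no b≰p′N = suc N , ≤-refl ,
       prefix-of-no-shorter y w≡by (≮⇒≥ (b≰p′N ∘ p′-proper-border-length N border))

p′-flanked-borders : ∀ N {a m} → IsFlankedBorder a m (p′ N) → ∃ λ j → j < N × letter j ≡ a × m ≡ p′ j
p′-flanked-borders N {a} flanked@(_ , (y , w≡may)) with j , j≤N , refl ← p′-borders N (flanked⇒border flanked) =
  j , j<N , letter≡a , refl
  where
  j≢N : j ≢ N
  j≢N refl with () ← ++-identityʳ-unique (p′ N) w≡may
  j<N : j < N
  j<N = ≤∧≢⇒< j≤N j≢N
  letter≡a : letter j ≡ a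
  letter≡a = proj₁ (∷-injective (++-cancelˡ (p′ j) _ _ (trans (sym (proj₂ (proj₂ (p′-flanked j<N)))) w≡may)))

enclose-p′-borders : ∀ N a b → (b ≢ [] × IsBorder b (enclose a (p′ N))) ⇔
  (b ≡ a ∷ [] ⊎ b ≡ enclose a (p′ N) ⊎ ∃ λ j → j < N × letter j ≡ a × b ≡ enclose a (p′ j))
enclose-p′-borders N a b =
  ⇔.trans (borders-enclose a (p′ N) b) (⇔.refl ⊎-⇔ ⇔.refl ⊎-⇔ mk⇔ to from)
  where
  to : (∃ λ m → IsFlankedBorder a m (p′ N) × b ≡ enclose a m) →
       ∃ λ j → j < N × letter j ≡ a × b ≡ enclose a (p′ j)
  to (m , flanked , refl) with j , j<N , refl , refl ← p′-flanked-borders N flanked = j , j<N , refl , refl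
  from : (∃ λ j → j < N × letter j ≡ a × b ≡ enclose a (p′ j)) →
         ∃ λ m → IsFlankedBorder a m (p′ N) × b ≡ enclose a m
  from (j , j<N , refl , refl) = p′ j , p′-flanked j<N , refl

double-suc+ : ∀ s c → 2 * suc s + c ≡ 2 + (2 * s + c)
double-suc+ = solve-∀

letter-2*+ : ∀ s c → letter (2 * s + c) ≡ letter c
letter-2*+ zero    c = refl
letter-2*+ (suc s) c = trans (cong letter (double-suc+ s c)) (letter-2*+ s c)

letter≡letter⇒parity : ∀ {c} → c < 2 → ∀ j → letter j ≡ letter c → ∃ λ s → j ≡ 2 * s + c
letter≡letter⇒parity {0} _ 0 _ = 0 , refl
letter≡letter⇒parity {1} _ 0 ()
letter≡letter⇒parity {0} _ 1 ()
letter≡letter⇒parity {1} _ 1 _ = 0 , refl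
letter≡letter⇒parity {c} c<2 (suc (suc j)) e with s , refl ← letter≡letter⇒parity c<2 j e =
  suc s , sym (double-suc+ s c)
letter≡letter⇒parity {suc (suc _)} (s≤s (s≤s ())) _ _

s≤n⇔2s+c<2n+1+c : ∀ {s n} c → s ≤ n ⇔ 2 * s + c < 2 * n + suc c
s≤n⇔2s+c<2n+1+c {s} {n} c = mk⇔
  (λ s≤n → subst (2 * s + c <_) (sym (+-suc (2 * n) c)) (s≤s (+-monoˡ-≤ c (*-monoʳ-≤ 2 s≤n))))
  (λ lt → *-cancelˡ-≤ 2 (+-cancelʳ-≤ c _ _ (≤-pred (subst (2 * s + c <_) (+-suc (2 * n) c) lt))))

p-reindex : ∀ {n i} c → i ≤ n → p (2 * (suc n ∸ i) + suc c) ≡ p′ (2 * (n ∸ i) + c)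
p-reindex {n} {i} c i≤n = begin
  p (2 * (suc n ∸ i) + suc c)  ≡⟨ cong (λ k → p (2 * k + suc c)) (+-∸-assoc 1 i≤n) ⟩
  p (2 * suc (n ∸ i) + suc c)  ≡⟨ cong p (index (n ∸ i) c) ⟩
  p (3 + (2 * (n ∸ i) + c))    ≡⟨ p≡p′ (2 * (n ∸ i) + c) ⟩
  p′ (2 * (n ∸ i) + c)         ∎
  where
  open ≡-Reasoning
  index : ∀ k c → 2 * suc k + suc c ≡ 3 + (2 * k + c)
  index = solve-∀

enclose-p-borders : ∀ n c → c < 2 → ∀ {k} b → k ≡ 3 + (2 * n + suc c) →
  IsNonemptyBorder b (enclose (letter c) (p k)) ⇔
  (b ≡ letter c ∷ [] ⊎ b ≡ enclose (letter c) (p k) ⊎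
   ∃ λ i → i < suc n × b ≡ enclose (letter c) (p (2 * (suc n ∸ i) + suc c)))
enclose-p-borders n c c<2 b refl rewrite p≡p′ (2 * n + suc c) =
  ⇔.trans (enclose-p′-borders N a b) (⇔.refl ⊎-⇔ ⇔.refl ⊎-⇔ mk⇔ to from)
  where
  N : ℕ
  N = 2 * n + suc c
  a : Bit
  a = letter c
  to : (∃ λ j → j < N × letter j ≡ a × b ≡ enclose a (p′ j)) →
       ∃ λ i → i < suc n × b ≡ enclose a (p (2 * (suc n ∸ i) + suc c))
  to (j , j<N , letter≡a , refl) with s , refl ← letter≡letter⇒parity c<2 j letter≡a =
    n ∸ s , s≤s (m∸n≤m n s) , cong (enclose a) (begin
      p′ (2 * s + c)                          ≡⟨ cong (λ t → p′ (2 * t + c)) (m∸[m∸n]≡n s≤n) ⟨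
      p′ (2 * (n ∸ (n ∸ s)) + c)              ≡⟨ p-reindex c (m∸n≤m n s) ⟨
      p (2 * (suc n ∸ (n ∸ s)) + suc c)       ∎)
    where
    open ≡-Reasoning
    s≤n : s ≤ n
    s≤n = Equivalence.from (s≤n⇔2s+c<2n+1+c c) j<N
  from : (∃ λ i → i < suc n × b ≡ enclose a (p (2 * (suc n ∸ i) + suc c))) →
         ∃ λ j → j < N × letter j ≡ a × b ≡ enclose a (p′ j)
  from (i , s≤s i≤n , refl) =
    2 * (n ∸ i) + c , Equivalence.to (s≤n⇔2s+c<2n+1+c c) (m∸n≤m n i) ,
    letter-2*+ (n ∸ i) c , cong (enclose a) (p-reindex c i≤n)

M₃-borders : ∀ b → IsNonemptyBorder b (M-odd 1) ⇔ (b ≡ 𝟏 ∷ [] ⊎ b ≡ 𝟏 ∷ 𝟏 ∷ [])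
M₃-borders b = ⇔.trans (enclose-p′-borders 0 𝟏 b) (mk⇔ (map₂ [ id , (λ ()) ∘ proj₁ ∘ proj₂ ]) (map₂ inj₁))

theorem3 :
    ((n : ℕ) → n ≥ 1 → (b : Word) →
      (IsNonemptyBorder b (M-even n) ⇔
        ((b ≡ 𝟎 ∷ []) ⊎ (b ≡ M-even n)
          ⊎ (∃ λ i → i < n × b ≡ 𝟎 ∷ (p (2 * (n ∸ i) + 1) ++ 𝟎 ∷ []))))
      × (IsNonemptyBorder b (M-odd (suc n)) ⇔
        ((b ≡ 𝟏 ∷ []) ⊎ (b ≡ M-odd (suc n))
          ⊎ (∃ λ i → i < n × b ≡ 𝟏 ∷ (p (2 * (n ∸ i) + 2) ++ 𝟏 ∷ [])))))
    × ((b : Word) →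
      (IsNonemptyBorder b (M-odd 1) ⇔ ((b ≡ 𝟏 ∷ []) ⊎ (b ≡ 𝟏 ∷ 𝟏 ∷ []))))
theorem3 = (λ { (suc n) _ b → enclose-p-borders n 0 (s≤s z≤n) b (even-index n) ,
                               enclose-p-borders n 1 (s≤s (s≤s z≤n)) b (odd-index n) }) ,
           M₃-borders
  where
  even-index : ∀ n → 2 * suc n + 2 ≡ 3 + (2 * n + 1)
  even-index = solve-∀
  odd-index : ∀ n → 2 * suc (suc n) + 1 ≡ 3 + (2 * n + 2)
  odd-index = solve-∀
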